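{- Let $\Lambda$ be a ring with identity and $A,B,C\in\Lambda$. For every $n\ge0$, $\sum w(\alpha)x^{\alpha_0}$, the sum extending over all walks $\alpha$ of length $n$ (not necessarily standard) with finish $0$, equals the element $(Ax+B+Cx^{ -1})^n$ of $\Lambda[x,x^{ -1}]$.
   Context: A walk of length $l\ge0$ is an $(l+1)$-tuple $\alpha=(\alpha_0,\dots,\alpha_l)$ of integers with each $\alpha_i-\alpha_{i-1}\in\{ -1,0,1\}$; its finish is $\alpha_l$. Its weight is $w(\alpha)=1$ if $l=0$, and otherwise $w(\alpha)=U_1\cdots U_l$ where $U_i=A,B,C$ according as $\alpha_i-\alpha_{i-1}=-1,0,1$. Here $x$ commutes with the elements of $\Lambda$. -}

module Defs where

open import Level using (Level)
open import Algebra.Bundles using (Ring)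
open import Data.Nat using (ℕ; zero; suc)
open import Data.Integer as ℤ using (ℤ; _≟_)
open import Data.Vec using (Vec; []; _∷_)
open import Data.List using (List; []; _∷_; _++_; map; concatMap; foldr)
open import Data.Product using (_×_; _,_; proj₁; proj₂)
open import Relation.Nullary using (does)
open import Data.Bool using (if_then_else_)

data Step : Set where
  down stay up : Step

stepℤ : Step → ℤ
stepℤ down = ℤ.-[1+ 0 ]
stepℤ stay = ℤ.+ 0
stepℤ up   = ℤ.+ 1

-- A walk of length l, α = (α₀,…,α_l), is determined by its start α₀ and
-- its l successive increments (each in {-1,0,1}).
record Walk (l : ℕ) : Set where
  constructor walk
  field
    start : ℤ
    steps : Vec Step l

open Walk public

disp : ∀ {l} → Vec Step l → ℤ
disp []       = ℤ.+ 0
disp (s ∷ ss) = stepℤ s ℤ.+ disp ss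

-- the vertex αᵢ (i ≤ l) is start + displacement of first i steps; the finish is α_l
finish : ∀ {l} → Walk l → ℤ
finish α = start α ℤ.+ disp (steps α)

allSteps : (l : ℕ) → List (Vec Step l)
allSteps zero    = [] ∷ []
allSteps (suc l) = concatMap (λ v → (down ∷ v) ∷ (stay ∷ v) ∷ (up ∷ v) ∷ []) (allSteps l)

module _ {c ℓ : Level} (Λ : Ring c ℓ) where
  open Ring Λ

  Σ : List Carrier → Carrier
  Σ = foldr _+_ 0#

  weightSteps : (A B C : Carrier) → ∀ {l} → Vec Step l → Carrier
  weightSteps A B C []          = 1#
  weightSteps A B C (down ∷ ss) = A * weightSteps A B C ss
  weightSteps A B C (stay ∷ ss) = B * weightSteps A B C ss
  weightSteps A B C (up   ∷ ss) = C * weightSteps A B C ss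

  weight : (A B C : Carrier) → ∀ {l} → Walk l → Carrier
  weight A B C α = weightSteps A B C (steps α)

  -- Laurent polynomials Λ[x,x⁻¹] (x central), as formal finite sums of
  -- monomials a·x^k; equality is equality of all coefficients.
  Laurent : Set c
  Laurent = List (Carrier × ℤ)

  coeff : Laurent → ℤ → Carrier
  coeff p k = Σ (map (λ m → if does (proj₂ m ≟ k) then proj₁ m else 0#) p)

  _≈L_ : Laurent → Laurent → Set ℓ
  p ≈L q = ∀ k → coeff p k ≈ coeff q k

  oneL : Laurent
  oneL = (1# , ℤ.+ 0) ∷ []

  -- (a x^i)(b x^j) = ab x^(i+j), since x commutes with Λ
  _*L_ : Laurent → Laurent → Laurent
  p *L q = concatMap (λ m → map (λ m' → (proj₁ m * proj₁ m' , proj₂ m ℤ.+ proj₂ m')) q) p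

  _^L_ : Laurent → ℕ → Laurent
  p ^L zero  = oneL
  p ^L suc n = p *L (p ^L n)

  baseL : (A B C : Carrier) → Laurent
  baseL A B C = (A , ℤ.+ 1) ∷ (B , ℤ.+ 0) ∷ (C , ℤ.-[1+ 0 ]) ∷ []

  -- The coefficient of x^k in  Σ_{α : length n, finish 0} w(α) x^{α₀}
  -- is the sum of w(α) over walks α of length n with α₀ = k and finish 0.
  -- Walks with start k are enumerated as  walk k ss  for all step vectors ss;
  -- those with finish 0 are selected by a decidable test.
  walksFromFinish0 : ℤ → (n : ℕ) → List (Walk n)
  walksFromFinish0 k n =
    foldr (λ α r → if does (finish α ≟ ℤ.+ 0) then α ∷ r else r) []
          (map (walk k) (allSteps n))

  walkSumCoeff : (A B C : Carrier) → ℕ → ℤ → Carrier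
  walkSumCoeff A B C n k = Σ (map (weight A B C) (walksFromFinish0 k n))

-- Both sides obey the same recursion in n. A walk of length n + 1 from k to 0 is a first
-- step s followed by a walk of length n from k + s to 0, so the walk-sum coefficient of
-- x^k is Σ_s w(s) · (walk-sum coefficient of x^(k+s) at length n); and the coefficient of x^k in
-- (A x + B + C x⁻¹) · q is A q(k-1) + B q(k) + C q(k+1), which is the same expression.
-- At n = 0 both sides are 1 if k = 0 and 0 otherwise.
module Submission where

open import Defs
open import Level using (Level)
open import Algebra.Bundles using (Ring; AbelianGroup)
open import Data.Nat using (ℕ; zero; suc)
open import Data.Integer as ℤ using (ℤ; +_; _≟_)
import Data.Integer.Properties as ℤₚ
open import Algebra.Properties.Group (AbelianGroup.group ℤₚ.+-0-abelianGroup) using (x≈z//y; //-rightDividesˡ)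
open import Data.Vec using (Vec; _∷_)
open import Data.List using (List; []; _∷_; _++_; map; concatMap; foldr)
open import Data.List.Properties using (map-++; map-∘)
open import Data.Product using (_,_; proj₁; proj₂)
open import Data.Bool using (true; false; if_then_else_)
open import Function.Bundles using (_⇔_; mk⇔)
open import Relation.Nullary.Decidable using (does; does-⇔)
open import Relation.Binary.PropositionalEquality as ≡ using (_≡_)
import Relation.Binary.Reasoning.Setoid as ≈-Reasoning

+-transposeˡ : ∀ i j k → (i ℤ.+ j ≡ k) ⇔ (j ≡ k ℤ.- i)
+-transposeˡ i j k = mk⇔
  (λ i+j≡k → x≈z//y j i k (≡.trans (ℤₚ.+-comm j i) i+j≡k))
  (λ { ≡.refl → ≡.trans (ℤₚ.+-comm i (k ℤ.- i)) (//-rightDividesˡ i k) })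

+0≡0⇔0≡ : ∀ k → (k ℤ.+ + 0 ≡ + 0) ⇔ (+ 0 ≡ k)
+0≡0⇔0≡ k = mk⇔ (λ eq → ≡.sym (≡.trans (≡.sym (ℤₚ.+-identityʳ k)) eq))
                 (λ { ≡.refl → ≡.refl })

module _ {c ℓ : Level} (Λ : Ring c ℓ) where
  open Ring Λ
  open ≈-Reasoning setoid

  private
    sum : List Carrier → Carrier
    sum = Σ Λ

  if-0-*ˡ : ∀ b a x → (if b then a * x else 0#) ≈ a * (if b then x else 0#)
  if-0-*ˡ true  a x = refl
  if-0-*ˡ false a x = sym (zeroʳ a)

  sum-++ : ∀ xs ys → sum (xs ++ ys) ≈ sum xs + sum ys
  sum-++ []       ys = sym (+-identityˡ _)
  sum-++ (x ∷ xs) ys = trans (+-congˡ (sum-++ xs ys)) (sym (+-assoc _ _ _))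

  private variable
    a b : Level
    I : Set a
    J : Set b

  sum-map-cong : ∀ {f g : I → Carrier} → (∀ i → f i ≈ g i) → ∀ is → sum (map f is) ≈ sum (map g is)
  sum-map-cong f≈g []       = refl
  sum-map-cong f≈g (i ∷ is) = +-cong (f≈g i) (sum-map-cong f≈g is)

  sum-map-0 : ∀ (is : List I) → sum (map (λ _ → 0#) is) ≈ 0#
  sum-map-0 []       = refl
  sum-map-0 (i ∷ is) = trans (+-identityˡ _) (sum-map-0 is)

  sum-map-+ : ∀ (f g : I → Carrier) is → sum (map (λ i → f i + g i) is) ≈ sum (map f is) + sum (map g is)
  sum-map-+ f g []       = sym (+-identityˡ 0#)
  sum-map-+ f g (i ∷ is) = begin
    (f i + g i) + sum (map (λ i → f i + g i) is)      ≈⟨ +-congˡ (sum-map-+ f g is) ⟩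
    (f i + g i) + (sum (map f is) + sum (map g is))   ≈⟨ +-interchange _ _ _ _ ⟩
    (f i + sum (map f is)) + (g i + sum (map g is))   ∎
    where open import Algebra.Properties.CommutativeSemigroup +-commutativeSemigroup
            using () renaming (interchange to +-interchange)

  sum-map-*ˡ : ∀ a (f : I → Carrier) is → sum (map (λ i → a * f i) is) ≈ a * sum (map f is)
  sum-map-*ˡ a f []       = sym (zeroʳ a)
  sum-map-*ˡ a f (i ∷ is) = trans (+-congˡ (sum-map-*ˡ a f is)) (sym (distribˡ a _ _))

  sum-concatMap : ∀ (f : J → Carrier) (g : I → List J) is →
                  sum (map f (concatMap g is)) ≈ sum (map (λ i → sum (map f (g i))) is)
  sum-concatMap f g []       = refl
  sum-concatMap f g (i ∷ is) = begin
    sum (map f (g i ++ concatMap g is))                         ≡⟨ ≡.cong sum (map-++ f (g i) _) ⟩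
    sum (map f (g i) ++ map f (concatMap g is))                 ≈⟨ sum-++ (map f (g i)) _ ⟩
    sum (map f (g i)) + sum (map f (concatMap g is))            ≈⟨ +-congˡ (sum-concatMap f g is) ⟩
    sum (map f (g i)) + sum (map (λ i → sum (map f (g i))) is)  ∎

  sum-comm : ∀ (f : I → J → Carrier) is js →
             sum (map (λ i → sum (map (f i) js)) is) ≈ sum (map (λ j → sum (map (λ i → f i j) is)) js)
  sum-comm f []       js = sym (sum-map-0 js)
  sum-comm f (i ∷ is) js = begin
    sum (map (f i) js) + sum (map (λ i → sum (map (f i) js)) is)          ≈⟨ +-congˡ (sum-comm f is js) ⟩
    sum (map (f i) js) + sum (map (λ j → sum (map (λ i → f i j) is)) js)  ≈⟨ sum-map-+ (f i) _ js ⟨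
    sum (map (λ j → f i j + sum (map (λ i → f i j) is)) js)               ∎

module _ {c ℓ : Level} (Λ : Ring c ℓ) (A B C : Ring.Carrier Λ) where
  open Ring Λ
  open ≈-Reasoning setoid

  private
    sum : List Carrier → Carrier
    sum = Σ Λ

  allStepsOne : List Step
  allStepsOne = down ∷ stay ∷ up ∷ []

  stepWeight : Step → Carrier
  stepWeight down = A
  stepWeight stay = B
  stepWeight up   = C

  -- The coefficient of x^k in (A x + B + C x⁻¹) · f.
  stepSum : (ℤ → Carrier) → ℤ → Carrier
  stepSum f k = sum (map (λ s → stepWeight s * f (k ℤ.+ stepℤ s)) allStepsOne)

  stepSum-cong : ∀ {f g} → (∀ k → f k ≈ g k) → ∀ k → stepSum f k ≈ stepSum g k
  stepSum-cong {f} f≈g k = sum-map-cong Λ {f = λ s → stepWeight s * f (k ℤ.+ stepℤ s)}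
    (λ s → *-congˡ (f≈g (k ℤ.+ stepℤ s))) allStepsOne

  weightSteps-∷ : ∀ {l} s (v : Vec Step l) →
                  weightSteps Λ A B C (s ∷ v) ≡ stepWeight s * weightSteps Λ A B C v
  weightSteps-∷ down v = ≡.refl
  weightSteps-∷ stay v = ≡.refl
  weightSteps-∷ up   v = ≡.refl

  closingWeight : ∀ {l} → ℤ → Vec Step l → Carrier
  closingWeight k v = if does (k ℤ.+ disp v ≟ + 0) then weightSteps Λ A B C v else 0#

  closingWeight-∷ : ∀ {l} k s (v : Vec Step l) →
                    closingWeight k (s ∷ v) ≈ stepWeight s * closingWeight (k ℤ.+ stepℤ s) v
  closingWeight-∷ k s v = begin
    closingWeight k (s ∷ v)
      ≡⟨ ≡.cong₂ (λ j x → if does (j ≟ + 0) then x else 0#)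
                 (≡.sym (ℤₚ.+-assoc k (stepℤ s) (disp v))) (weightSteps-∷ s v) ⟩
    (if does ((k ℤ.+ stepℤ s) ℤ.+ disp v ≟ + 0) then stepWeight s * weightSteps Λ A B C v else 0#)
      ≈⟨ if-0-*ˡ Λ _ (stepWeight s) _ ⟩
    stepWeight s * closingWeight (k ℤ.+ stepℤ s) v ∎

  closingSum : ∀ {l} → List (Vec Step l) → ℤ → Carrier
  closingSum vs k = sum (map (closingWeight k) vs)

  closingSum-extend : ∀ {l} (vs : List (Vec Step l)) k →
    closingSum (concatMap (λ v → map (_∷ v) allStepsOne) vs) k ≈ stepSum (closingSum vs) k
  closingSum-extend vs k = begin
    sum (map (closingWeight k) (concatMap (λ v → map (_∷ v) allStepsOne) vs))
      ≈⟨ sum-concatMap Λ (closingWeight k) (λ v → map (_∷ v) allStepsOne) vs ⟩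
    sum (map (λ v → sum (map (λ s → closingWeight k (s ∷ v)) allStepsOne)) vs)
      ≈⟨ sum-map-cong Λ (λ v → sum-map-cong Λ (λ s → closingWeight-∷ k s v) allStepsOne) vs ⟩
    sum (map (λ v → sum (map (λ s → stepWeight s * closingWeight (k ℤ.+ stepℤ s) v) allStepsOne)) vs)
      ≈⟨ sum-comm Λ (λ v s → stepWeight s * closingWeight (k ℤ.+ stepℤ s) v) vs allStepsOne ⟩
    sum (map (λ s → sum (map (λ v → stepWeight s * closingWeight (k ℤ.+ stepℤ s) v) vs)) allStepsOne)
      ≈⟨ sum-map-cong Λ (λ s → sum-map-*ˡ Λ (stepWeight s) (closingWeight (k ℤ.+ stepℤ s)) vs) allStepsOne ⟩
    stepSum (closingSum vs) k ∎

  -- walksFromFinish0 k n is walksFinishingAt0 k (allSteps n), generalised to any list of steps.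
  walksFinishingAt0 : ∀ {l} → ℤ → List (Vec Step l) → List (Walk l)
  walksFinishingAt0 k vs =
    foldr (λ α r → if does (finish α ≟ + 0) then α ∷ r else r) [] (map (walk k) vs)

  sum-weight-walksFinishingAt0 : ∀ {l} k (vs : List (Vec Step l)) →
    sum (map (weight Λ A B C) (walksFinishingAt0 k vs)) ≈ closingSum vs k
  sum-weight-walksFinishingAt0 k []       = refl
  sum-weight-walksFinishingAt0 k (v ∷ vs) with does (k ℤ.+ disp v ≟ + 0)
  ... | true  = +-congˡ (sum-weight-walksFinishingAt0 k vs)
  ... | false = trans (sum-weight-walksFinishingAt0 k vs) (sym (+-identityˡ _))

  coeff-scale-shift : ∀ a i (q : Laurent Λ) k →
    coeff Λ (map (λ m → a * proj₁ m , i ℤ.+ proj₂ m) q) k ≈ a * coeff Λ q (k ℤ.- i)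
  coeff-scale-shift a i q k = begin
    coeff Λ (map (λ m → a * proj₁ m , i ℤ.+ proj₂ m) q) k
      ≡⟨ ≡.cong sum (≡.sym (map-∘ q)) ⟩
    sum (map (λ m → if does (i ℤ.+ proj₂ m ≟ k) then a * proj₁ m else 0#) q)
      ≈⟨ sum-map-cong Λ shift q ⟩
    sum (map (λ m → a * (if does (proj₂ m ≟ k ℤ.- i) then proj₁ m else 0#)) q)
      ≈⟨ sum-map-*ˡ Λ a _ q ⟩
    a * coeff Λ q (k ℤ.- i) ∎
    where
    shift : ∀ m → (if does (i ℤ.+ proj₂ m ≟ k) then a * proj₁ m else 0#)
                ≈ a * (if does (proj₂ m ≟ k ℤ.- i) then proj₁ m else 0#)
    shift (b , j) rewrite does-⇔ (+-transposeˡ i j k) (i ℤ.+ j ≟ k) (j ≟ k ℤ.- i) =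
      if-0-*ˡ Λ _ a b

  -- By computation, baseL is the list of monomials stepWeight s · x^(-s) over the three steps s.
  coeff-baseL-* : ∀ q k → coeff Λ (_*L_ Λ (baseL Λ A B C) q) k ≈ stepSum (coeff Λ q) k
  coeff-baseL-* q k = begin
    coeff Λ (_*L_ Λ (baseL Λ A B C) q) k
      ≈⟨ sum-concatMap Λ _ (λ m → map (λ m' → proj₁ m * proj₁ m' , proj₂ m ℤ.+ proj₂ m') q) (baseL Λ A B C) ⟩
    sum (map (λ s → coeff Λ (map (λ m → stepWeight s * proj₁ m , ℤ.- stepℤ s ℤ.+ proj₂ m) q) k) allStepsOne)
      ≈⟨ sum-map-cong Λ scale-shift allStepsOne ⟩
    stepSum (coeff Λ q) k ∎
    where
    scale-shift : ∀ s → coeff Λ (map (λ m → stepWeight s * proj₁ m , ℤ.- stepℤ s ℤ.+ proj₂ m) q) k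
                        ≈ stepWeight s * coeff Λ q (k ℤ.+ stepℤ s)
    scale-shift s = trans (coeff-scale-shift (stepWeight s) (ℤ.- stepℤ s) q k)
      (*-congˡ (reflexive (≡.cong (λ j → coeff Λ q (k ℤ.+ j)) (ℤₚ.neg-involutive (stepℤ s)))))

  closingSum≈coeff-^L : ∀ n k → closingSum (allSteps n) k ≈ coeff Λ (_^L_ Λ (baseL Λ A B C) n) k
  closingSum≈coeff-^L zero    k = reflexive (≡.cong (λ b → (if b then 1# else 0#) + 0#)
    (does-⇔ (+0≡0⇔0≡ k) (k ℤ.+ + 0 ≟ + 0) (+ 0 ≟ k)))
  closingSum≈coeff-^L (suc n) k = begin
    closingSum (allSteps (suc n)) k                  ≈⟨ closingSum-extend (allSteps n) k ⟩
    stepSum (closingSum (allSteps n)) k              ≈⟨ stepSum-cong (closingSum≈coeff-^L n) k ⟩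
    stepSum (coeff Λ (_^L_ Λ (baseL Λ A B C) n)) k   ≈⟨ coeff-baseL-* (_^L_ Λ (baseL Λ A B C) n) k ⟨
    coeff Λ (_^L_ Λ (baseL Λ A B C) (suc n)) k       ∎

theorem3p1 : ∀ {c ℓ : Level} (Λ : Ring c ℓ) (A B C : Ring.Carrier Λ) (n : ℕ) (k : ℤ) →
    Ring._≈_ Λ (walkSumCoeff Λ A B C n k) (coeff Λ (_^L_ Λ (baseL Λ A B C) n) k)
theorem3p1 Λ A B C n k = Ring.trans Λ
  (sum-weight-walksFinishingAt0 Λ A B C k (allSteps n))
  (closingSum≈coeff-^L Λ A B C n k)
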